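{- Let $k\ge 1$ and $n\ge 3k+1$ be integers. Then every subset $A\subseteq [n]$ with $|A|=3k-2$ contains an independent set of size $k$ in $W_n$. Consequently, every subset of $[n]$ of cardinality at most $n-3k+2$ is a face of $\Delta_k^t(W_n)$.
   Context: For $n\ge 1$, the squared cycle graph $W_n$ has vertex set $[n]=\{1,\dots,n\}$ and edge set $\{\{i,i+1 \bmod n\},\{i,i+2 \bmod n\} : i=1,\dots,n\}$. An independent set of size $k$ is a set of $k$ pairwise non-adjacent vertices. For a graph $G=(V,E)$ and integer $k\ge1$, the $k$-total cut complex $\Delta_k^t(G)$ is the simplicial complex on $V$ whose facets are the sets $V\setminus S$ for $S$ an independent set of size $k$ in $G$; its faces are all subsets of such complements. -}

module Defs where

open import Data.Nat using (ℕ; _+_; NonZero)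
open import Data.Nat.DivMod using (_%_)
open import Data.Fin using (Fin; toℕ)
open import Data.Fin.Subset using (Subset; _∈_; _⊆_; ∁; ∣_∣)
open import Data.Product using (Σ; _×_)
open import Data.Sum using (_⊎_)
open import Relation.Binary.PropositionalEquality using (_≡_; _≢_)
open import Relation.Nullary using (¬_)

-- Vertices of W_n: Fin n, where vertex i : Fin n stands for i+1 ∈ [n].
-- Edges {i, i+1 mod n} and {i, i+2 mod n}.
EdgeFrom : (n : ℕ) → .{{_ : NonZero n}} → Fin n → Fin n → Set
EdgeFrom n i j = (toℕ j ≡ (toℕ i + 1) % n) ⊎ (toℕ j ≡ (toℕ i + 2) % n)

Adj : (n : ℕ) → .{{_ : NonZero n}} → Fin n → Fin n → Set
Adj n i j = EdgeFrom n i j ⊎ EdgeFrom n j i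

IsIndependent : (n : ℕ) → .{{_ : NonZero n}} → Subset n → Set
IsIndependent n S = ∀ i j → i ∈ S → j ∈ S → i ≢ j → ¬ Adj n i j

IsFaceTotalCut : (n : ℕ) → .{{_ : NonZero n}} → ℕ → Subset n → Set
IsFaceTotalCut n k F =
  Σ (Subset n) (λ S → IsIndependent n S × ∣ S ∣ ≡ k × F ⊆ ∁ S)

-- Number the vertices of W_n by 0, …, n − 1; then S is independent iff its points are pairwise at
-- cyclic distance at least 3. We induct on k, cutting three consecutive vertices out of the
-- cycle (ℤ/n becomes ℤ/(n − 3)) while losing at most three points of A, so that both
-- n ≥ 3k + 1 and |A| ≥ 3k − 2 pass to (n − 3, k − 1).
-- After a rotation the last vertex n − 1 lies in A and either
--   * the last three vertices all lie in A: an independent (k − 1)-set S of the shorter cycle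
--     extends by the vertex n − 3 + min(2, min S), which is at distance ≥ 3 from S both ways; or
--   * vertex 0 is not in A and the last three vertices hold at most two points of A: discard
--     vertex 1 from A as well, so S avoids 0 and 1 and extends by the vertex n − 1.
-- The second statement applies the first to the complement of F.

module Submission where

open import Defs
open import Data.Nat using (ℕ; NonZero; _+_; _*_; _∸_; _≤_)
open import Data.Fin.Subset using (Subset; _⊆_; ∣_∣)
open import Data.Product using (Σ; _×_)
open import Relation.Binary.PropositionalEquality using (_≡_)

open import Data.Bool using (Bool; true; false; T; _∧_; _∨_; if_then_else_)
open import Data.Bool.ListAction using (any)
open import Data.Bool.Properties using (T-∧)
open import Data.Empty using (⊥; ⊥-elim)
open import Data.Fin as Fin using (Fin; toℕ)
open import Data.Fin.Properties using (toℕ-injective; toℕ<n)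
open import Data.Fin.Subset using (∁; inside; outside) renaming (_∈_ to _∈ₛ_)
open import Data.Fin.Subset.Properties using (x∈∁p⇒x∉p; x∉p⇒x∈∁p; ∣∁p∣≡n∸∣p∣)
open import Data.List using (List; []; _∷_; length; map)
open import Data.List.Properties using (length-map)
open import Data.List.Membership.Propositional using (_∈_)
open import Data.List.Relation.Unary.All as All using (All; []; _∷_)
open import Data.List.Relation.Unary.All.Properties using (map⁺; All¬⇒¬Any)
open import Data.List.Relation.Unary.AllPairs as AllPairs using (AllPairs; []; _∷_)
open import Data.List.Relation.Unary.Any as Any using (here; there)
open import Data.List.Relation.Unary.Any.Properties using (any⁻)
open import Data.Nat using (suc; zero; _<_; _<ᵇ_; _≡ᵇ_; _≟_; z≤n; s≤s; z<s; s<s)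
open import Data.Nat.DivMod using (_%_; _/_; m≡m%n+[m/n]*n)
open import Data.Nat.Properties
open import Data.Nat.Tactic.RingSolver using (solve-∀)
open import Data.List.Extrema ≤-totalOrder using (min; min≤⊤; min≤xs; argmin-sel)
open import Data.Product using (_,_; proj₁; proj₂; ∃)
open import Data.Sum using (_⊎_; inj₁; inj₂)
open import Data.Vec using (_∷_; []; here; there)
open import Function using (_∘_; id; case_of_; Equivalence)
open import Relation.Binary.PropositionalEquality
  using (refl; sym; trans; cong; cong₂; subst; _≢_; module ≡-Reasoning)
open import Relation.Nullary using (¬_; yes; no; T?; ¬?)

bit : Bool → ℕ
bit true  = 1
bit false = 0

count : (ℕ → Bool) → ℕ → ℕ
count f zero    = 0
count f (suc n) = bit (f 0) + count (f ∘ suc) n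

count-cong : ∀ {f g} n → (∀ {j} → j < n → f j ≡ g j) → count f n ≡ count g n
count-cong zero    eq = refl
count-cong (suc n) eq = cong₂ _+_ (cong bit (eq z<s)) (count-cong n (eq ∘ s<s))

count-snoc : ∀ f n → count f (suc n) ≡ count f n + bit (f n)
count-snoc f zero    = +-comm (bit (f 0)) 0
count-snoc f (suc n) = trans (cong (bit (f 0) +_) (count-snoc (f ∘ suc) n))
                             (sym (+-assoc (bit (f 0)) _ _))

count-true : ∀ f n → 0 < count f n → ∃ λ j → j < n × T (f j)
count-true f (suc n) pos with f 0 in eq
... | true  = 0 , z<s , subst T (sym eq) _
... | false with count-true (f ∘ suc) n pos
...   | j , j<n , fj = suc j , s<s j<n , fj

bit-T : ∀ {b} → T b → bit b ≡ 1
bit-T {true} _ = refl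

bit-¬T : ∀ {b} → ¬ T b → bit b ≡ 0
bit-¬T {true}  ¬b = ⊥-elim (¬b _)
bit-¬T {false} _  = refl

bit≤1 : ∀ b → bit b ≤ 1
bit≤1 true  = ≤-refl
bit≤1 false = z≤n

bit-∧ : ∀ a b → ¬ T (a ∧ b) → bit a + bit b ≤ 1
bit-∧ true  true  ¬ab = ⊥-elim (¬ab _)
bit-∧ true  false _   = ≤-refl
bit-∧ false b     _   = bit≤1 b

count-last3 : ∀ B m → count B (3 + m) ≡ count B m + (bit (B m) + bit (B (1 + m)) + bit (B (2 + m)))
count-last3 B m = begin
  count B (3 + m)                                                   ≡⟨ count-snoc B (2 + m) ⟩
  count B (2 + m) + bit (B (2 + m))                                 ≡⟨ cong (_+ bit (B (2 + m))) (count-snoc B (1 + m)) ⟩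
  count B (1 + m) + bit (B (1 + m)) + bit (B (2 + m))               ≡⟨ cong (λ c → c + bit (B (1 + m)) + bit (B (2 + m))) (count-snoc B m) ⟩
  count B m + bit (B m) + bit (B (1 + m)) + bit (B (2 + m))         ≡⟨ cong (_+ bit (B (2 + m))) (+-assoc (count B m) _ _) ⟩
  count B m + (bit (B m) + bit (B (1 + m))) + bit (B (2 + m))       ≡⟨ +-assoc (count B m) _ _ ⟩
  count B m + (bit (B m) + bit (B (1 + m)) + bit (B (2 + m)))       ∎
  where open ≡-Reasoning

Spaced : ℕ → ℕ → ℕ → Set
Spaced n x y = x + 3 ≤ y × y + 3 ≤ x + n

-- For x, y < n: x and y are at cyclic distance at least 3, i.e. distinct and non-adjacent in W_n.
Apart : ℕ → ℕ → ℕ → Set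
Apart n x y = Spaced n x y ⊎ Spaced n y x

Apart-sym : ∀ {n x y} → Apart n x y → Apart n y x
Apart-sym (inj₁ s) = inj₂ s
Apart-sym (inj₂ s) = inj₁ s

Apart⇒≢ : ∀ {n x y} → Apart n x y → x ≢ y
Apart⇒≢ {x = x} (inj₁ (x+3≤x , _)) refl = m+1+n≰m x x+3≤x
Apart⇒≢ {x = x} (inj₂ (x+3≤x , _)) refl = m+1+n≰m x x+3≤x

Apart-mono : ∀ {m n x y} → m ≤ n → Apart m x y → Apart n x y
Apart-mono {x = x} m≤n (inj₁ (p , q)) = inj₁ (p , ≤-trans q (+-monoʳ-≤ x m≤n))
Apart-mono {y = y} m≤n (inj₂ (p , q)) = inj₂ (p , ≤-trans q (+-monoʳ-≤ y m≤n))

Apart⇒+3≤+n : ∀ {n x y} → Apart n x y → y + 3 ≤ x + n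
Apart⇒+3≤+n         (inj₁ (_ , q)) = q
Apart⇒+3≤+n {x = x} (inj₂ (p , _)) = ≤-trans p (m≤m+n x _)

next : ℕ → ℕ → ℕ
next n j = if suc j <ᵇ n then suc j else 0

next-view : ∀ {n j} → j < n → (suc j < n × next n j ≡ suc j) ⊎ (suc j ≡ n × next n j ≡ 0)
next-view {n} {j} j<n with suc j <ᵇ n in eq
... | true  = inj₁ (<ᵇ⇒< _ _ (subst T (sym eq) _) , refl)
... | false = inj₂ (≤-antisym j<n (≮⇒≥ λ lt → subst T eq (<⇒<ᵇ lt)) , refl)

next-suc : ∀ {n j} → suc j < n → next n j ≡ suc j
next-suc {j = j} sj<n with next-view (<-trans (n<1+n j) sj<n)
... | inj₁ (_ , e)    = e
... | inj₂ (refl , _) = ⊥-elim (<-irrefl refl sj<n)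

next-last : ∀ n → next (suc n) n ≡ 0
next-last n with next-view (n<1+n n)
... | inj₁ (sn<sn , _) = ⊥-elim (<-irrefl refl sn<sn)
... | inj₂ (_ , e)     = e

next-< : ∀ {n j} → j < n → next n j < n
next-< j<n with next-view j<n
... | inj₁ (sj<n , e) rewrite e = sj<n
... | inj₂ (_ , e)    rewrite e = ≤-<-trans z≤n j<n

Spaced-next : ∀ {n x y} → y < n → Spaced n x y → Apart n (next n x) (next n y)
Spaced-next {x = x} {y} y<n (x+3≤y , y+3≤x+n)
  with next-view (<-trans (<-≤-trans (m<m+n x z<s) x+3≤y) y<n) | next-view y<n
... | inj₂ (refl , _) | _ = ⊥-elim (m+1+n≰m x (≤-trans x+3≤y (≤-pred y<n)))
... | inj₁ (_ , ex) | inj₁ (_ , ey) rewrite ex | ey = inj₁ (s≤s x+3≤y , s≤s y+3≤x+n)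
... | inj₁ (_ , ex) | inj₂ (refl , ey) rewrite ex | ey =
  inj₂ (+-cancelˡ-≤ y 3 (suc x) (subst (y + 3 ≤_) (x+1+y≡y+1+x) y+3≤x+n) , s≤s x+3≤y)
  where
  x+1+y≡y+1+x : x + suc y ≡ y + suc x
  x+1+y≡y+1+x = trans (+-suc x y) (trans (cong suc (+-comm x y)) (sym (+-suc y x)))

Apart-next : ∀ {n x y} → x < n → y < n → Apart n x y → Apart n (next n x) (next n y)
Apart-next x<n y<n (inj₁ s) = Spaced-next y<n s
Apart-next x<n y<n (inj₂ s) = Apart-sym (Spaced-next x<n s)

count-next : ∀ f n → count (f ∘ next n) n ≡ count f n
count-next f zero    = refl
count-next f (suc m) = begin
  count (f ∘ next (suc m)) (suc m)                  ≡⟨ count-snoc _ m ⟩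
  count (f ∘ next (suc m)) m + bit (f (next (suc m) m))
    ≡⟨ cong₂ _+_ (count-cong m (λ j<m → cong f (next-suc (s<s j<m)))) (cong (bit ∘ f) (next-last m)) ⟩
  count (f ∘ suc) m + bit (f 0)                     ≡⟨ +-comm _ (bit (f 0)) ⟩
  count f (suc m)                                   ∎
  where open ≡-Reasoning

shift : ℕ → ℕ → ℕ → ℕ
shift n zero    j = j
shift n (suc q) j = shift n q (next n j)

shift-next : ∀ n q j → shift n q (next n j) ≡ next n (shift n q j)
shift-next n zero    j = refl
shift-next n (suc q) j = shift-next n q (next n j)

shift-+ : ∀ {n} q j → j + q < n → shift n q j ≡ j + q
shift-+     zero    j _  = sym (+-identityʳ j)
shift-+ {n} (suc q) j lt = begin
  shift n q (next n j) ≡⟨ cong (shift n q) (next-suc (≤-<-trans (s≤s (m≤m+n j q)) lt′)) ⟩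
  shift n q (suc j)    ≡⟨ shift-+ q (suc j) lt′ ⟩
  suc j + q            ≡⟨ +-suc j q ⟨
  j + suc q            ∎
  where
  open ≡-Reasoning
  lt′ : suc j + q < n
  lt′ = subst (_< n) (+-suc j q) lt

shift-< : ∀ {n j} q → j < n → shift n q j < n
shift-< zero    j<n = j<n
shift-< (suc q) j<n = shift-< q (next-< j<n)

Apart-shift : ∀ {n x y} q → x < n → y < n → Apart n x y → Apart n (shift n q x) (shift n q y)
Apart-shift zero    _   _   a = a
Apart-shift (suc q) x<n y<n a = Apart-shift q (next-< x<n) (next-< y<n) (Apart-next x<n y<n a)

count-shift : ∀ f n q → count (f ∘ shift n q) n ≡ count f n
count-shift f n zero    = refl
count-shift f n (suc q) = trans (count-next (f ∘ shift n q) n) (count-shift f n q)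

AllPairs-map-on : {A B : Set} {P : A → Set} {R : A → A → Set} {S : B → B → Set} (f : A → B) →
  (∀ {x y} → P x → P y → R x y → S (f x) (f y)) →
  ∀ {xs} → All P xs → AllPairs R xs → AllPairs S (map f xs)
AllPairs-map-on f h []         []         = []
AllPairs-map-on f h (px ∷ pxs) (rx ∷ rxs) =
  map⁺ (All.zipWith (λ (py , r) → h px py r) (pxs , rx)) ∷ AllPairs-map-on f h pxs rxs

AllPairs-∈ : {A : Set} {R : A → A → Set} {xs : List A} {x y : A} →
  AllPairs R xs → x ∈ xs → y ∈ xs → x ≢ y → R x y ⊎ R y x
AllPairs-∈ (r ∷ rs) (here refl) (here refl) x≢y = ⊥-elim (x≢y refl)
AllPairs-∈ (r ∷ rs) (here refl) (there y∈) _    = inj₁ (All.lookup r y∈)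
AllPairs-∈ (r ∷ rs) (there x∈)  (here refl) _   = inj₂ (All.lookup r x∈)
AllPairs-∈ (r ∷ rs) (there x∈)  (there y∈) x≢y  = AllPairs-∈ rs x∈ y∈ x≢y

record Spread (n k : ℕ) (A : ℕ → Bool) : Set where
  field
    points  : List ℕ
    size    : length points ≡ k
    bounded : All (_< n) points
    chosen  : All (T ∘ A) points
    apart   : AllPairs (Apart n) points

open Spread

Spread-apart : ∀ {n k A x y} (S : Spread n k A) → x ∈ points S → y ∈ points S → x ≢ y → Apart n x y
Spread-apart S x∈ y∈ x≢y with AllPairs-∈ (apart S) x∈ y∈ x≢y
... | inj₁ a = a
... | inj₂ a = Apart-sym a

Spread-mono : ∀ {n k A B} → (∀ {x} → T (A x) → T (B x)) → Spread n k A → Spread n k B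
Spread-mono A⊆B S = record
  { points = points S ; size = size S ; bounded = bounded S
  ; chosen = All.map A⊆B (chosen S) ; apart = apart S }

Spread-unshift : ∀ {n k A} q → Spread n k (A ∘ shift n q) → Spread n k A
Spread-unshift {n} q S = record
  { points  = map (shift n q) (points S)
  ; size    = trans (length-map (shift n q) (points S)) (size S)
  ; bounded = map⁺ (All.map (shift-< q) (bounded S))
  ; chosen  = map⁺ (chosen S)
  ; apart   = AllPairs-map-on (shift n q) (Apart-shift q) (bounded S) (apart S)
  }

-- Every point of a spread set of ℤ/m keeps distance at least 3 from r + m in ℤ/(3 + m).
Insertable : ℕ → ℕ → List ℕ → Set
Insertable m r = All (λ s → r ≤ s × s + 3 ≤ r + m)

Spread-extend : ∀ {m k A} r → r ≤ 2 → T (A (r + m)) → (S : Spread m k A) →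
  Insertable m r (points S) → Spread (3 + m) (suc k) A
Spread-extend {m} r r≤2 Ar S insertable = record
  { points  = r + m ∷ points S
  ; size    = cong suc (size S)
  ; bounded = +-monoˡ-< m (s≤s r≤2) ∷ All.map (λ s<m → <-≤-trans s<m (m≤n+m m 3)) (bounded S)
  ; chosen  = Ar ∷ chosen S
  ; apart   = All.map (λ (r≤s , s+3≤r+m) → inj₂ (s+3≤r+m , wrap r≤s)) insertable
              ∷ AllPairs.map (Apart-mono (m≤n+m m 3)) (apart S)
  }
  where
  wrap : ∀ {s} → r ≤ s → r + m + 3 ≤ s + (3 + m)
  wrap {s} r≤s = begin
    r + m + 3   ≡⟨ +-assoc r m 3 ⟩
    r + (m + 3) ≡⟨ cong (r +_) (+-comm m 3) ⟩
    r + (3 + m) ≤⟨ +-monoˡ-≤ (3 + m) r≤s ⟩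
    s + (3 + m) ∎
    where open ≤-Reasoning

m<n⇒m+3≤2+n : ∀ {m n} → m < n → m + 3 ≤ 2 + n
m<n⇒m+3≤2+n {m} {n} m<n = begin
  m + 3     ≡⟨ +-suc m 2 ⟩
  suc m + 2 ≤⟨ +-monoˡ-≤ 2 m<n ⟩
  n + 2     ≡⟨ +-comm n 2 ⟩
  2 + n     ∎
  where open ≤-Reasoning

min-insertable : ∀ {m k A} → 3 ≤ m → (S : Spread m k A) → Insertable m (min 2 (points S)) (points S)
min-insertable {m} 3≤m S = All.zip (min≤xs 2 (points S) , wrapped (argmin-sel id 2 (points S)))
  where
  t : ℕ
  t = min 2 (points S)
  wrapped : t ≡ 2 ⊎ t ∈ points S → All (λ s → s + 3 ≤ t + m) (points S)
  wrapped (inj₁ t≡2) = All.map (λ {s} s<m → subst (λ u → s + 3 ≤ u + m) (sym t≡2) (m<n⇒m+3≤2+n s<m)) (bounded S)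
  wrapped (inj₂ t∈S) = All.tabulate λ {s} s∈S → case s ≟ t of λ where
    (yes refl) → +-monoʳ-≤ s 3≤m
    (no s≢t)   → Apart⇒+3≤+n (Spread-apart S t∈S s∈S (s≢t ∘ sym))

run-end-between : ∀ (f : ℕ → Bool) {t} p → t ≤ p → T (f t) → ¬ T (f p) →
  ∃ λ i → i < p × T (f i) × ¬ T (f (suc i))
run-end-between f zero    z≤n ft ¬fp = ⊥-elim (¬fp ft)
run-end-between f (suc p) t≤p ft ¬fp with T? (f p)
... | yes fp  = p , n<1+n p , fp , ¬fp
... | no ¬fp′ with run-end-between f p (≤-pred (≤∧≢⇒< t≤p λ { refl → ¬fp ft })) ft ¬fp′
...   | i , i<p , fi , ¬fsi = i , m<n⇒m<1+n i<p , fi , ¬fsi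

run-end : ∀ {n t p} (A : ℕ → Bool) → t < n → p < n → T (A t) → ¬ T (A p) →
  ∃ λ i → i < n × T (A i) × ¬ T (A (next n i))
run-end {suc n} A t<n p<n At ¬Ap with T? (A n) | T? (A 0)
... | no ¬An | _ with run-end-between A n (≤-pred t<n) At ¬An
...   | i , i<n , Ai , ¬Asi = i , m<n⇒m<1+n i<n , Ai , subst (¬_ ∘ T ∘ A) (sym (next-suc (s<s i<n))) ¬Asi
run-end {suc n} A t<n p<n At ¬Ap | yes An | no ¬A0 =
  n , n<1+n n , An , subst (¬_ ∘ T ∘ A) (sym (next-last n)) ¬A0
run-end {suc n} {p = p} A t<n p<n At ¬Ap | yes An | yes A0 with run-end-between A p z≤n A0 ¬Ap
... | i , i<p , Ai , ¬Asi = i , <-trans i<p p<n , Ai , subst (¬_ ∘ T ∘ A) (sym (next-suc (≤-<-trans i<p p<n))) ¬Asi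

EndBlock : ℕ → (ℕ → Bool) → Set
EndBlock m B = T (B m) × T (B (1 + m)) × T (B (2 + m))

EndGap : ℕ → (ℕ → Bool) → Set
EndGap m B = T (B (2 + m)) × ¬ T (B 0) × ¬ T (B m ∧ B (1 + m))

rotate-to-endBlock-or-endGap : ∀ m A → 0 < count A (3 + m) →
  ∃ λ q → EndBlock m (A ∘ shift (3 + m) q) ⊎ EndGap m (A ∘ shift (3 + m) q)
rotate-to-endBlock-or-endGap m A pos with anyUpTo? (λ j → ¬? (T? (A j))) (3 + m)
... | no noGap = 0 , inj₁ (inA (+-monoˡ-< m {0} z<s) , inA (+-monoˡ-< m {1} (s<s z<s)) , inA (n<1+n (2 + m)))
  where
  inA : ∀ {j} → j < 3 + m → T (A j)
  inA {j} j<n with T? (A j)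
  ... | yes Aj = Aj
  ... | no ¬Aj = ⊥-elim (noGap (j , j<n , ¬Aj))
... | yes (p , p<n , ¬Ap) with count-true A (3 + m) pos
...   | t , t<n , At with run-end A t<n p<n At ¬Ap
...     | i , i<n , Ai , ¬Ani = suc i , endOrGap
  where
  B : ℕ → Bool
  B = A ∘ shift (3 + m) (suc i)
  B-last : T (B (2 + m))
  B-last = subst (T ∘ A) (sym (trans (cong (shift (3 + m) i) (next-last (2 + m))) (shift-+ i 0 i<n))) Ai
  ¬B0 : ¬ T (B 0)
  ¬B0 = subst (¬_ ∘ T ∘ A) (sym (trans (shift-next (3 + m) i 0) (cong (next (3 + m)) (shift-+ i 0 i<n)))) ¬Ani
  endOrGap : EndBlock m B ⊎ EndGap m B
  endOrGap with T? (B m ∧ B (1 + m))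
  ... | yes Bm∧ = let (Bm , Bm+1) = Equivalence.to T-∧ Bm∧ in inj₁ (Bm , Bm+1 , B-last)
  ... | no ¬Bm∧ = inj₂ (B-last , ¬B0 , ¬Bm∧)

count-endBlock : ∀ {m B} → EndBlock m B → count B (3 + m) ≡ 3 + count B m
count-endBlock {m} {B} (Bm , Bm+1 , Bm+2) =
  trans (count-last3 B m)
        (trans (cong (count B m +_) (cong₂ _+_ (cong₂ _+_ (bit-T Bm) (bit-T Bm+1)) (bit-T Bm+2)))
               (+-comm (count B m) 3))

EndBlock-∈ : ∀ {m B r} → EndBlock m B → r ≤ 2 → T (B (r + m))
EndBlock-∈ {r = zero}          (Bm , _ , _) _ = Bm
EndBlock-∈ {r = suc zero}      (_ , Bm+1 , _) _ = Bm+1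
EndBlock-∈ {r = suc (suc zero)} (_ , _ , Bm+2) _ = Bm+2
EndBlock-∈ {r = suc (suc (suc _))} _ (s≤s (s≤s ()))

dropTwo : (ℕ → Bool) → ℕ → Bool
dropTwo B zero          = false
dropTwo B (suc zero)    = false
dropTwo B (suc (suc j)) = B (suc (suc j))

dropTwo-sub : ∀ {B x} → T (dropTwo B x) → 2 ≤ x × T (B x)
dropTwo-sub {x = suc (suc x)} Bx = s≤s (s≤s z≤n) , Bx

count-dropTwo : ∀ B m → ¬ T (B 0) → count B m ≤ 1 + count (dropTwo B) m
count-dropTwo B zero          _   = z≤n
count-dropTwo B (suc zero)    ¬B0 rewrite bit-¬T ¬B0 = z≤n
count-dropTwo B (suc (suc m)) ¬B0 rewrite bit-¬T ¬B0 = +-monoˡ-≤ _ (bit≤1 (B 1))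

count-endGap : ∀ {m B} → EndGap m B → count B (3 + m) ≤ 3 + count (dropTwo B) m
count-endGap {m} {B} (_ , ¬B0 , ¬Bm∧) = begin
  count B (3 + m)                                              ≡⟨ count-last3 B m ⟩
  count B m + (bit (B m) + bit (B (1 + m)) + bit (B (2 + m)))  ≤⟨ +-mono-≤ (count-dropTwo B m ¬B0) (+-mono-≤ (bit-∧ (B m) (B (1 + m)) ¬Bm∧) (bit≤1 (B (2 + m)))) ⟩
  1 + count (dropTwo B) m + 2                                  ≡⟨ +-comm (1 + count (dropTwo B) m) 2 ⟩
  3 + count (dropTwo B) m                                      ∎
  where open ≤-Reasoning

spread-exists-suc : ∀ k m A → k * 3 < m → k * 3 < count A (3 + m) → Spread (3 + m) (suc k) A
spread-exists-suc zero m A _ nonempty with count-true A (3 + m) nonempty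
... | t , t<n , At = record
  { points = t ∷ [] ; size = refl ; bounded = t<n ∷ [] ; chosen = At ∷ [] ; apart = [] ∷ [] }
spread-exists-suc (suc k) (suc (suc (suc m))) A (s≤s (s≤s (s≤s k*3<m))) many
  with rotate-to-endBlock-or-endGap (3 + m) A (≤-trans (s≤s z≤n) many)
... | q , inj₁ block =
  Spread-unshift q (Spread-extend r r≤2 (EndBlock-∈ {B = B} block r≤2) S (min-insertable (m≤m+n 3 m) S))
  where
  B : ℕ → Bool
  B = A ∘ shift (6 + m) q
  enough : k * 3 < count B (3 + m)
  enough = +-cancelˡ-< 3 _ _ (begin-strict
    3 + k * 3           <⟨ many ⟩
    count A (6 + m)     ≡⟨ count-shift A (6 + m) q ⟨
    count B (6 + m)     ≡⟨ count-endBlock {B = B} block ⟩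
    3 + count B (3 + m) ∎)
    where open ≤-Reasoning
  S : Spread (3 + m) (suc k) B
  S = spread-exists-suc k m B k*3<m enough
  r : ℕ
  r = min 2 (points S)
  r≤2 : r ≤ 2
  r≤2 = min≤⊤ 2 (points S)
... | q , inj₂ gap =
  Spread-unshift q (Spread-extend 2 ≤-refl (proj₁ gap) (Spread-mono (proj₂ ∘ dropTwo-sub {B}) S) insertable)
  where
  B : ℕ → Bool
  B = A ∘ shift (6 + m) q
  enough : k * 3 < count (dropTwo B) (3 + m)
  enough = +-cancelˡ-< 3 _ _ (begin-strict
    3 + k * 3                     <⟨ many ⟩
    count A (6 + m)               ≡⟨ count-shift A (6 + m) q ⟨
    count B (6 + m)               ≤⟨ count-endGap {B = B} gap ⟩
    3 + count (dropTwo B) (3 + m) ∎)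
    where open ≤-Reasoning
  S : Spread (3 + m) (suc k) (dropTwo B)
  S = spread-exists-suc k m (dropTwo B) k*3<m enough
  insertable : Insertable (3 + m) 2 (points S)
  insertable = All.zipWith (λ (Ds , s<n) → proj₁ (dropTwo-sub {B} Ds) , m<n⇒m+3≤2+n s<n) (chosen S , bounded S)

spread-exists : ∀ k n A → 3 * suc k + 1 ≤ n → 3 * suc k ∸ 2 ≤ count A n → Spread n (suc k) A
spread-exists k n A n≥ many =
  spread-exists-3+ (subst (_≤ n) (bound≡ k) n≥) (subst (_≤ count A n) (cong (_∸ 2) (size≡ k)) many)
  where
  bound≡ : ∀ k → 3 * suc k + 1 ≡ 3 + suc (k * 3)
  bound≡ = solve-∀
  size≡ : ∀ k → 3 * suc k ≡ 2 + suc (k * 3)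
  size≡ = solve-∀
  spread-exists-3+ : ∀ {n} → 3 + suc (k * 3) ≤ n → k * 3 < count A n → Spread n (suc k) A
  spread-exists-3+ {suc (suc (suc m))} (s≤s (s≤s (s≤s k*3<m))) = spread-exists-suc k m A k*3<m

count-false : ∀ n → count (λ _ → false) n ≡ 0
count-false zero    = refl
count-false (suc n) = count-false n

count-insert : ∀ f y n → y < n → ¬ T (f y) → count (λ j → (j ≡ᵇ y) ∨ f j) n ≡ suc (count f n)
count-insert f zero    (suc n) _         ¬fy rewrite bit-¬T ¬fy = refl
count-insert f (suc y) (suc n) (s<s y<n) ¬fy =
  trans (cong (bit (f 0) +_) (count-insert (f ∘ suc) y n y<n ¬fy)) (+-suc (bit (f 0)) _)

T-any-≡ᵇ⇒∈ : ∀ {x} xs → T (any (x ≡ᵇ_) xs) → x ∈ xs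
T-any-≡ᵇ⇒∈ {x} xs t = Any.map (≡ᵇ⇒≡ x _) (any⁻ (x ≡ᵇ_) xs t)

count-any-≡ᵇ : ∀ {n} xs → All (_< n) xs → AllPairs _≢_ xs → count (λ j → any (j ≡ᵇ_) xs) n ≡ length xs
count-any-≡ᵇ {n} []       _          _             = count-false n
count-any-≡ᵇ {n} (y ∷ ys) (y<n ∷ ys<n) (y∉ys ∷ ys!) =
  trans (count-insert (λ j → any (j ≡ᵇ_) ys) y n y<n (All¬⇒¬Any y∉ys ∘ T-any-≡ᵇ⇒∈ ys))
        (cong suc (count-any-≡ᵇ ys ys<n ys!))

member : ∀ {n} → Subset n → ℕ → Bool
member []      _       = false
member (b ∷ p) zero    = b
member (b ∷ p) (suc j) = member p j

∈⇒T-member : ∀ {n} {p : Subset n} {i} → i ∈ₛ p → T (member p (toℕ i))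
∈⇒T-member here        = _
∈⇒T-member (there i∈p) = ∈⇒T-member i∈p

T-member⇒∈ : ∀ {n} (p : Subset n) i → T (member p (toℕ i)) → i ∈ₛ p
T-member⇒∈ (true ∷ p) Fin.zero    _ = here
T-member⇒∈ (b ∷ p)    (Fin.suc i) t = there (T-member⇒∈ p i t)

count-member : ∀ {n} (p : Subset n) → count (member p) n ≡ ∣ p ∣
count-member []            = refl
count-member (outside ∷ p) = count-member p
count-member (inside ∷ p)  = cong suc (count-member p)

fromPredicate : (n : ℕ) → (ℕ → Bool) → Subset n
fromPredicate zero    f = []
fromPredicate (suc n) f = f 0 ∷ fromPredicate n (f ∘ suc)

member-fromPredicate : ∀ {n j} f → j < n → member (fromPredicate n f) j ≡ f j
member-fromPredicate {j = zero}  f (s<s _)   = refl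
member-fromPredicate {j = suc j} f (s<s j<n) = member-fromPredicate (f ∘ suc) j<n

∣fromPredicate∣ : ∀ n f → ∣ fromPredicate n f ∣ ≡ count f n
∣fromPredicate∣ n f = trans (sym (count-member (fromPredicate n f))) (count-cong n (member-fromPredicate f))

∈fromPredicate⇒T : ∀ {n f i} → i ∈ₛ fromPredicate n f → T (f (toℕ i))
∈fromPredicate⇒T {f = f} {i} i∈ = subst T (member-fromPredicate f (toℕ<n i)) (∈⇒T-member i∈)

-- With x + c = y + q n: q = 0 puts y just after x, and q > 0 puts y + n at most 2 after x.
Apart⇒≢[+c]% : ∀ {n x y c} .{{_ : NonZero n}} → Apart n x y → c ≤ 2 → y ≢ (x + c) % n
Apart⇒≢[+c]% {n} {x} {y} {c} a c≤2 y≡ =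
  absurd a (subst (λ r → x + c ≡ r + ((x + c) / n) * n) (sym y≡) (m≡m%n+[m/n]*n (x + c) n))
  where
  3≰c : ¬ (x + 3 ≤ x + c)
  3≰c le = <-irrefl refl (≤-trans (+-cancelˡ-≤ x 3 c le) c≤2)
  absurd : Apart n x y → x + c ≡ y + ((x + c) / n) * n → ⊥
  absurd (inj₁ (x+3≤y , _)) eq = 3≰c (≤-trans x+3≤y (≤-trans (m≤m+n y _) (≤-reflexive (sym eq))))
  absurd (inj₂ (y+3≤x , x+3≤y+n)) eq with (x + c) / n
  ... | zero  = m+1+n≰m x (≤-trans (+-monoˡ-≤ 3 x≤y) y+3≤x)
    where
    x≤y : x ≤ y
    x≤y = subst (x ≤_) (trans eq (+-identityʳ y)) (m≤m+n x c)
  ... | suc q = 3≰c (≤-trans x+3≤y+n (≤-trans (+-monoʳ-≤ y (m≤m+n n (q * n))) (≤-reflexive (sym eq))))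

Apart⇒¬EdgeFrom : ∀ {n} .{{_ : NonZero n}} {i j : Fin n} → Apart n (toℕ i) (toℕ j) → ¬ EdgeFrom n i j
Apart⇒¬EdgeFrom a (inj₁ e) = Apart⇒≢[+c]% a (s≤s z≤n) e
Apart⇒¬EdgeFrom a (inj₂ e) = Apart⇒≢[+c]% a ≤-refl e

Apart⇒¬Adj : ∀ {n} .{{_ : NonZero n}} {i j : Fin n} → Apart n (toℕ i) (toℕ j) → ¬ Adj n i j
Apart⇒¬Adj a (inj₁ e) = Apart⇒¬EdgeFrom a e
Apart⇒¬Adj a (inj₂ e) = Apart⇒¬EdgeFrom (Apart-sym a) e

Spread⇒independent : ∀ {n k} .{{_ : NonZero n}} (A : Subset n) → Spread n k (member A) →
  Σ (Subset n) λ S → S ⊆ A × IsIndependent n S × ∣ S ∣ ≡ k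
Spread⇒independent {n} {k} A S = I , I⊆A , independent , ∣I∣≡k
  where
  I : Subset n
  I = fromPredicate n (λ j → any (j ≡ᵇ_) (points S))
  ∈I⇒∈points : ∀ {i} → i ∈ₛ I → toℕ i ∈ points S
  ∈I⇒∈points i∈I = T-any-≡ᵇ⇒∈ (points S) (∈fromPredicate⇒T i∈I)
  I⊆A : I ⊆ A
  I⊆A {i} i∈I = T-member⇒∈ A i (All.lookup (chosen S) (∈I⇒∈points i∈I))
  independent : IsIndependent n I
  independent i j i∈I j∈I i≢j =
    Apart⇒¬Adj (Spread-apart S (∈I⇒∈points i∈I) (∈I⇒∈points j∈I) (i≢j ∘ toℕ-injective))
  ∣I∣≡k : ∣ I ∣ ≡ k
  ∣I∣≡k = trans (∣fromPredicate∣ n _)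
            (trans (count-any-≡ᵇ (points S) (bounded S) (AllPairs.map Apart⇒≢ (apart S))) (size S))

independent-subset : ∀ k n .{{_ : NonZero n}} → 1 ≤ k → 3 * k + 1 ≤ n → (A : Subset n) → 3 * k ∸ 2 ≤ ∣ A ∣ →
  Σ (Subset n) λ S → S ⊆ A × IsIndependent n S × ∣ S ∣ ≡ k
independent-subset (suc k) n _ n≥ A many =
  Spread⇒independent A (spread-exists k n (member A) n≥ (subst (_ ≤_) (sym (count-member A)) many))

o≤n∸m+2⇒m∸2≤n∸o : ∀ {m n o} → 2 ≤ m → m ≤ n → o ≤ n ∸ m + 2 → m ∸ 2 ≤ n ∸ o
o≤n∸m+2⇒m∸2≤n∸o {m} {n} {o} 2≤m m≤n o≤ = m+n≤o⇒m≤o∸n (m ∸ 2) (begin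
  m ∸ 2 + o             ≤⟨ +-monoʳ-≤ (m ∸ 2) o≤ ⟩
  m ∸ 2 + (n ∸ m + 2)   ≡⟨ cong (m ∸ 2 +_) (+-comm (n ∸ m) 2) ⟩
  m ∸ 2 + (2 + (n ∸ m)) ≡⟨ +-assoc (m ∸ 2) 2 (n ∸ m) ⟨
  m ∸ 2 + 2 + (n ∸ m)   ≡⟨ cong (_+ (n ∸ m)) (m∸n+n≡m 2≤m) ⟩
  m + (n ∸ m)           ≡⟨ m+[n∸m]≡n m≤n ⟩
  n                     ∎)
  where open ≤-Reasoning

lemma3p1 : (k n : ℕ) → .{{_ : NonZero n}} → 1 ≤ k → 3 * k + 1 ≤ n →
    ((A : Subset n) → ∣ A ∣ ≡ 3 * k ∸ 2 →
      Σ (Subset n) (λ S → S ⊆ A × IsIndependent n S × ∣ S ∣ ≡ k))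
    × ((F : Subset n) → ∣ F ∣ ≤ (n ∸ 3 * k) + 2 → IsFaceTotalCut n k F)
lemma3p1 k n 1≤k n≥ = (λ A ∣A∣≡ → independent-subset k n 1≤k n≥ A (≤-reflexive (sym ∣A∣≡))) , face
  where
  face : (F : Subset n) → ∣ F ∣ ≤ (n ∸ 3 * k) + 2 → IsFaceTotalCut n k F
  face F ∣F∣≤ with independent-subset k n 1≤k n≥ (∁ F) ∁F-large
    where
    ∁F-large : 3 * k ∸ 2 ≤ ∣ ∁ F ∣
    ∁F-large = subst (3 * k ∸ 2 ≤_) (sym (∣∁p∣≡n∸∣p∣ F))
                 (o≤n∸m+2⇒m∸2≤n∸o (≤-trans (n≤1+n 2) (*-monoʳ-≤ 3 1≤k)) (≤-trans (m≤m+n (3 * k) 1) n≥) ∣F∣≤)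
  ... | S , S⊆∁F , independent , ∣S∣≡k =
    S , independent , ∣S∣≡k , λ x∈F → x∉p⇒x∈∁p λ x∈S → x∈∁p⇒x∉p (S⊆∁F x∈S) x∈F
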